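{- Fix $k\in\mathbb{N}$. For any $n\leq k$ and any $\mathcal{L}$-sentence $A$ with parameters from $D^k_n$ containing only the predicate symbol $P$, $$\mathcal{M}_S,n\models A\iff \mathcal{M}_k,n\models A.$$
   Context: Language $\mathcal{L}$: individual variables, $\top,\bot$, $\neg,\to$, $\forall$, $\Box$, and predicate symbols; $P$ is a fixed unary predicate symbol. Kripke models $\langle W,\prec,\{D_w\},\Vdash\rangle$ with increasing domains; truth at a world is standard: atomic by $\Vdash$, $\forall u B(u)$ true at $w$ iff $B(a)$ true at $w$ for all $a\in D_w$, $\Box B$ true at $w$ iff $B$ true at all $v$ with $w\prec v$. $\mathcal{M}_S=\langle\mathbb{N},\prec,\{D_n\},\Vdash\rangle$ with $m\prec n$ iff $n<m$, $D_n=\{m\in\mathbb{N}:m\geq n\}$, $n\Vdash P(m)$ iff $m\neq n+1$. For $k\in\mathbb{N}$, $\mathcal{M}_k=\langle W_k,\prec_k,\{D^k_n\}_{n\in W_k},\Vdash_k\rangle$ with $W_k=\{0,1,\ldots,k\}$, $m\prec_k n$ iff $n<m$, $D^k_n=\{n,n+1,\ldots,k+2\}$, and $n\Vdash_k P(m)$ iff $m\neq n+1$. -}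

module Defs where

open import Data.Nat using (ℕ; zero; suc; _+_; _≤_; _<_)
open import Data.Fin using (Fin; toℕ)
open import Data.Product using (_×_)
open import Data.Unit using (⊤)
open import Data.Empty using (⊥)
open import Relation.Nullary using (¬_)
open import Relation.Binary.PropositionalEquality using (_≢_)

-- Terms with v bound (de Bruijn) variables; parameters are natural numbers
-- (all domains of the models in question are subsets of ℕ).
data Term (v : ℕ) : Set where
  var : Fin v → Term v
  par : ℕ → Term v

data Formula (v : ℕ) : Set where
  ⊤'  : Formula v
  ⊥'  : Formula v
  P'  : Term v → Formula v
  ¬'_ : Formula v → Formula v
  _⇒'_ : Formula v → Formula v → Formula v
  ∀'  : Formula (suc v) → Formula v
  □'  : Formula v → Formula v

Sentence : Set
Sentence = Formula 0

ParamsTerm : ∀ {v} → (ℕ → Set) → Term v → Set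
ParamsTerm Q (var _) = ⊤
ParamsTerm Q (par a) = Q a

Params : ∀ {v} → (ℕ → Set) → Formula v → Set
Params Q ⊤' = ⊤
Params Q ⊥' = ⊤
Params Q (P' t) = ParamsTerm Q t
Params Q (¬' A) = Params Q A
Params Q (A ⇒' B) = Params Q A × Params Q B
Params Q (∀' A) = Params Q A
Params Q (□' A) = Params Q A

-- Kripke models (for the language with the single unary predicate P),
-- with individuals drawn from ℕ; D w a means a ∈ D_w.
record KModel : Set₁ where
  field
    W   : Set
    _≺_ : W → W → Set
    D   : W → ℕ → Set
    PF  : W → ℕ → Set      -- PF w a  means  w ⊩ P(a)

extend : ∀ {v} → ℕ → (Fin v → ℕ) → Fin (suc v) → ℕ
extend a ρ Fin.zero = a
extend a ρ (Fin.suc i) = ρ i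

evalT : ∀ {v} → (Fin v → ℕ) → Term v → ℕ
evalT ρ (var i) = ρ i
evalT ρ (par a) = a

Sat : ∀ {v} (M : KModel) → KModel.W M → (Fin v → ℕ) → Formula v → Set
Sat M w ρ ⊤' = ⊤
Sat M w ρ ⊥' = ⊥
Sat M w ρ (P' t) = KModel.PF M w (evalT ρ t)
Sat M w ρ (¬' A) = ¬ Sat M w ρ A
Sat M w ρ (A ⇒' B) = Sat M w ρ A → Sat M w ρ B
Sat M w ρ (∀' A) = (a : ℕ) → KModel.D M w a → Sat M w (extend a ρ) A
Sat M w ρ (□' A) = (u : KModel.W M) → KModel._≺_ M w u → Sat M u ρ A

noVars : Fin 0 → ℕ
noVars ()

_,_⊨_ : (M : KModel) → KModel.W M → Sentence → Set
M , w ⊨ A = Sat M w noVars A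

MS : KModel
MS = record
  { W = ℕ
  ; _≺_ = λ m n → n < m
  ; D = λ n m → n ≤ m
  ; PF = λ n m → m ≢ suc n
  }

Mk : ℕ → KModel
Mk k = record
  { W = Fin (suc k)
  ; _≺_ = λ m n → toℕ n < toℕ m
  ; D = λ n m → toℕ n ≤ m × m ≤ k + 2
  ; PF = λ n m → m ≢ suc (toℕ n)
  }

Dk : ℕ → ℕ → ℕ → Set
Dk k n m = n ≤ m × m ≤ k + 2

module Submission where

-- The truth of a sentence is invariant under a bisimulation of Kripke models
-- with increasing domains, provided the bisimulation maps individuals by a
-- single function h that fixes the parameters of the sentence.
--
-- For the lemma itself, the world n of 𝓜_k is related to the world n of 𝓜_S
-- and individuals are truncated at k + 2, h a = a ⊓ (k + 2).  Truncation fixes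
-- every element of D^k_n, and since the only individual on which P fails at a
-- world n ≤ k is n + 1 < k + 2, truncation respects P; this gives the
-- bisimulation 'truncation', and lemma3p4 is the instance of 'preserve'.

open import Defs
open import Data.Nat using (ℕ; suc; _+_; _≤_; _<_; s≤s; s<s; _⊓_)
open import Data.Nat.Properties
  using (≤-total; ≤-trans; n≤1+n; <⇒≤; <⇒≢; <-trans; +-comm;
         m≤n⇒m⊓n≡m; m≥n⇒m⊓n≡n; m⊓n≤n; ⊓-glb)
open import Data.Fin using (Fin; toℕ; fromℕ<)
open import Data.Fin.Properties using (toℕ<n; toℕ-fromℕ<)
open import Data.Product using (Σ; _×_; _,_; proj₂)
open import Data.Unit using (tt)
open import Data.Empty using (⊥-elim)
open import Data.Sum using (inj₁; inj₂)
open import Function.Bundles using (_⇔_; mk⇔; Equivalence)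
open import Function.Related.TypeIsomorphisms using (→-cong-⇔; ¬-cong-⇔)
open import Relation.Binary.PropositionalEquality using (_≡_; refl; sym; trans; subst)

open Equivalence using (to; from)

Params-mono : ∀ {v} {Q R : ℕ → Set} → (∀ a → Q a → R a) →
              (A : Formula v) → Params Q A → Params R A
Params-mono Q⊆R ⊤' _ = tt
Params-mono Q⊆R ⊥' _ = tt
Params-mono Q⊆R (P' (var _)) _ = tt
Params-mono Q⊆R (P' (par a)) q = Q⊆R a q
Params-mono Q⊆R (¬' A) q = Params-mono Q⊆R A q
Params-mono Q⊆R (A ⇒' B) (qA , qB) = Params-mono Q⊆R A qA , Params-mono Q⊆R B qB
Params-mono Q⊆R (∀' A) q = Params-mono Q⊆R A q
Params-mono Q⊆R (□' A) q = Params-mono Q⊆R A q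

module _ (M N : KModel) where
  private
    module M = KModel M
    module N = KModel N

  record Bisimulation : Set₁ where
    field
      _∼_       : M.W → N.W → Set
      h         : ℕ → ℕ
      atom-⇔    : ∀ {w w'} → w ∼ w' → (a : ℕ) → M.PF w a ⇔ N.PF w' (h a)
      dom-forth : ∀ {w w' a} → w ∼ w' → M.D w a → N.D w' (h a)
      dom-back  : ∀ {w w' b} → w ∼ w' → N.D w' b → Σ ℕ λ a → M.D w a × h a ≡ b
      zig       : ∀ {w w' u} → w ∼ w' → w M.≺ u → Σ N.W λ u' → w' N.≺ u' × u ∼ u'
      zag       : ∀ {w w' u'} → w ∼ w' → w' N.≺ u' → Σ M.W λ u → w M.≺ u × u ∼ u'

module Preservation {M N : KModel} (B : Bisimulation M N) where
  open Bisimulation B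

  Fixed : ℕ → Set
  Fixed a = h a ≡ a

  Tracks : ∀ {v} → (Fin v → ℕ) → (Fin v → ℕ) → Set
  Tracks ρ σ = ∀ i → σ i ≡ h (ρ i)

  eval-tracks : ∀ {v} {ρ σ : Fin v → ℕ} (t : Term v) → ParamsTerm Fixed t →
                Tracks ρ σ → evalT σ t ≡ h (evalT ρ t)
  eval-tracks (var i) _ T = T i
  eval-tracks (par a) fixed _ = sym fixed

  tracks-extend : ∀ {v} {ρ σ : Fin v → ℕ} {a b : ℕ} →
                  Tracks ρ σ → b ≡ h a → Tracks (extend a ρ) (extend b σ)
  tracks-extend T b≡ha Fin.zero = b≡ha
  tracks-extend T b≡ha (Fin.suc i) = T i

  preserve : ∀ {v} (A : Formula v) → Params Fixed A →
             ∀ {w w'} → w ∼ w' → ∀ {ρ σ} → Tracks ρ σ →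
             Sat M w ρ A ⇔ Sat N w' σ A
  preserve ⊤' _ _ _ = mk⇔ (λ _ → tt) (λ _ → tt)
  preserve ⊥' _ _ _ = mk⇔ (λ ()) (λ ())
  preserve (P' t) q {w} {w'} r {ρ} T =
    subst (λ b → KModel.PF M w (evalT ρ t) ⇔ KModel.PF N w' b)
          (sym (eval-tracks t q T)) (atom-⇔ r (evalT ρ t))
  preserve (¬' A) q r T = ¬-cong-⇔ (preserve A q r T)
  preserve (A ⇒' C) (qA , qC) r T = →-cong-⇔ (preserve A qA r T) (preserve C qC r T)
  preserve (∀' A) q {w} {w'} r {ρ} {σ} T = mk⇔ forth back
    where
      forth : Sat M w ρ (∀' A) → Sat N w' σ (∀' A)
      forth H b d with dom-back r d
      ... | a , d' , ha≡b = to (preserve A q r (tracks-extend T (sym ha≡b))) (H a d')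
      back : Sat N w' σ (∀' A) → Sat M w ρ (∀' A)
      back H a d = from (preserve A q r (tracks-extend T refl)) (H (h a) (dom-forth r d))
  preserve (□' A) q {w} {w'} r {ρ} {σ} T = mk⇔ forth back
    where
      forth : Sat M w ρ (□' A) → Sat N w' σ (□' A)
      forth H u' lt with zag r lt
      ... | u , lt' , r' = to (preserve A q r' T) (H u lt')
      back : Sat N w' σ (□' A) → Sat M w ρ (□' A)
      back H u lt with zig r lt
      ... | u' , lt' , r' = from (preserve A q r' T) (H u' lt')

  preserve-sentence : (A : Sentence) → Params Fixed A →
                      ∀ {w w'} → w ∼ w' → (M , w ⊨ A) ⇔ (N , w' ⊨ A)
  preserve-sentence A q r = preserve A q r (λ ())

module Truncation (k : ℕ) where

  truncate : ℕ → ℕ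
  truncate a = a ⊓ (k + 2)

  truncate-fixes : ∀ {a} → a ≤ k + 2 → truncate a ≡ a
  truncate-fixes = m≤n⇒m⊓n≡m

  truncate-≡ : ∀ {a c} → c < k + 2 → a ≡ c ⇔ truncate a ≡ c
  truncate-≡ {a} {c} c<K = mk⇔ back forth
    where
      forth : truncate a ≡ c → a ≡ c
      forth e with ≤-total a (k + 2)
      ... | inj₁ a≤K = trans (sym (truncate-fixes a≤K)) e
      ... | inj₂ K≤a = ⊥-elim (<⇒≢ c<K (trans (sym e) (m≥n⇒m⊓n≡n K≤a)))
      back : a ≡ c → truncate a ≡ c
      back refl = truncate-fixes (<⇒≤ c<K)

  -- The individual n + 1 on which P fails at a world n ≤ k is below k + 2.
  successor-below-bound : (w : Fin (suc k)) → suc (toℕ w) < k + 2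
  successor-below-bound w = subst (suc (toℕ w) <_) (+-comm 2 k) (s<s (toℕ<n w))

  -- Every world n of 𝓜_k is at most k + 2, so n ≤ a implies n ≤ truncate a.
  world-below-bound : (w : Fin (suc k)) → toℕ w ≤ k + 2
  world-below-bound w = ≤-trans (n≤1+n _) (<⇒≤ (successor-below-bound w))

  truncation : Bisimulation MS (Mk k)
  truncation = record
    { _∼_       = λ m w → toℕ w ≡ m
    ; h         = truncate
    ; atom-⇔    = λ { {w' = w} refl a →
                      ¬-cong-⇔ (truncate-≡ (successor-below-bound w)) }
    ; dom-forth = λ { {w' = w} {a} refl m≤a →
                      ⊓-glb m≤a (world-below-bound w) , m⊓n≤n a (k + 2) }
    ; dom-back  = λ { {b = b} refl (m≤b , b≤K) → b , m≤b , truncate-fixes b≤K }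
    ; zig       = λ { {w' = w} refl u<m →
                      let u≤k = <-trans u<m (toℕ<n w) in
                      fromℕ< u≤k , subst (_< toℕ w) (sym (toℕ-fromℕ< u≤k)) u<m
                                 , toℕ-fromℕ< u≤k }
    ; zag       = λ { {u' = u} refl lt → toℕ u , lt , refl }
    }

lemma3p4 : (k n : ℕ) (n≤k : n ≤ k) (A : Sentence) → Params (Dk k n) A →
    (MS , n ⊨ A) ⇔ (Mk k , fromℕ< (s≤s n≤k) ⊨ A)
lemma3p4 k n n≤k A params =
  preserve-sentence A (Params-mono (λ a a∈D → truncate-fixes (proj₂ a∈D)) A params)
                      (toℕ-fromℕ< (s≤s n≤k))
  where
    open Truncation k
    open Preservation truncation
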